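{- Let $S$ be a read-$k$ per-read-monotone sequence over $X=\{x_1,\dots,x_s\}$. Then there is $X'\subseteq X$ with $|X'|\ge s/3^{k^2}$ such that $S|_{X'}$ is per-read-monotone and $k$-regularly-interleaving.
   Context: A sequence $S$ of elements of a finite set $X$ is read-$k$ if every element of $X$ occurs exactly $k$ times. For $i\in[k]$, $S^{(i)}$ is the subsequence of $i$-th occurrences, and for $i\neq j$, $S^{(i,j)}$ is the subsequence consisting of the $i$-th and $j$-th occurrences (a read-$2$ sequence). For $X'\subseteq X$, $S|_{X'}$ is obtained by deleting all occurrences of elements of $X\setminus X'$. The elements are labeled $x_1,\dots,x_s$ in the order of their first occurrence in $S$, and $X$ is ordered $x_1<\dots<x_s$. $S$ is per-read-monotone if every $S^{(i)}$ is monotone (increasing or decreasing) in this order. A read-$2$ sequence over $X$ is $2$-regularly-interleaving if there is a partition of $X$ into blocks $X_1,\dots,X_t$ such that for each block $X_i$: for each $c\in\{1,2\}$ the $c$-th occurrences (within that read-$2$ sequence) of the elements of $X_i$ form a contiguous interval, and the interval of second occurrences of $X_i$ immediately follows the interval of first occurrences of $X_i$. A read-$k$ sequence is $k$-regularly-interleaving if $S^{(i,j)}$ is $2$-regularly-interleaving for all $i\neq j\in[k]$. -}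

module Defs where

open import Data.Nat using (ℕ; zero; suc; _+_; _<_; _≤_)
open import Data.Fin using (Fin; toℕ) renaming (_≟_ to _≟F_)
open import Data.Fin.Subset using (Subset; _∈_)
open import Data.Fin.Subset.Properties using (_∈?_)
open import Data.List using (List; []; _∷_; map; filter; length; lookup)
open import Data.List.Relation.Unary.AllPairs using (AllPairs)
open import Data.Product using (_×_; _,_; proj₁; proj₂; ∃-syntax; Σ-syntax)
open import Data.Sum using (_⊎_)
open import Data.Bool using (if_then_else_)
open import Relation.Nullary using (¬_)
open import Relation.Nullary.Decidable using (⌊_⌋; _⊎-dec_)
open import Relation.Binary.PropositionalEquality using (_≡_)
open import Function.Bundles using (_⇔_)
import Data.Nat as ℕ

-- A sequence over X = {x_0,...,x_{s-1}} is a list of elements of Fin s.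
Seq : ℕ → Set
Seq s = List (Fin s)

occurrences : ∀ {s} → Fin s → Seq s → ℕ
occurrences x S = length (filter (x ≟F_) S)

ReadK : ∀ {s} → ℕ → Seq s → Set
ReadK {s} k S = ∀ (x : Fin s) → occurrences x S ≡ k

-- annotate each entry with its (0-based) occurrence index:
-- the entry is the (c+1)-th occurrence of its element
annot : ∀ {s} → Seq s → List (Fin s × ℕ)
annot [] = []
annot (x ∷ xs) =
  (x , 0) ∷ map (λ p → (proj₁ p , (if ⌊ proj₁ p ≟F x ⌋ then suc (proj₂ p) else proj₂ p)))
                (annot xs)

-- S^{(i)} (0-based i): subsequence of (i+1)-th occurrences
read : ∀ {s} → ℕ → Seq s → Seq s
read i S = map proj₁ (filter (λ p → proj₂ p ℕ.≟ i) (annot S))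

-- S^{(i,j)}: subsequence of (i+1)-th and (j+1)-th occurrences
read2 : ∀ {s} → ℕ → ℕ → Seq s → Seq s
read2 i j S = map proj₁ (filter (λ p → (proj₂ p ℕ.≟ i) ⊎-dec (proj₂ p ℕ.≟ j)) (annot S))

restrict : ∀ {s} → Subset s → Seq s → Seq s
restrict X' S = filter (_∈? X') S

-- position of the first occurrence of x in S; this realises the labeling
-- x_1 < ... < x_s by order of first occurrence
firstPos : ∀ {s} → Seq s → Fin s → ℕ
firstPos [] x = 0
firstPos (y ∷ ys) x = if ⌊ x ≟F y ⌋ then 0 else suc (firstPos ys x)

MonotoneIn : ∀ {s} → Seq s → Seq s → Set
MonotoneIn S T =
  AllPairs (λ a b → firstPos S a < firstPos S b) T
  ⊎ AllPairs (λ a b → firstPos S b < firstPos S a) T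

PerReadMonotone : ∀ {s} → ℕ → Seq s → Set
PerReadMonotone k S = ∀ (i : ℕ) → i < k → MonotoneIn S (read i S)

-- A read-2 sequence T is 2-regularly-interleaving: there is a partition of the
-- elements into blocks (block β = elements x with blk x ≡ β) such that for every
-- block, the positions of first occurrences form an interval [a, a+m) and the
-- positions of second occurrences form the interval [a+m, a+m+m') immediately after.
TwoRegInterleaving : ∀ {s} → Seq s → Set
TwoRegInterleaving {s} T =
  Σ[ blk ∈ (Fin s → ℕ) ] ∀ (β : ℕ) → ∃[ a ] ∃[ m ] ∃[ m′ ]
    ∀ (p : Fin (length (annot T))) →
      ((blk (proj₁ (lookup (annot T) p)) ≡ β × proj₂ (lookup (annot T) p) ≡ 0)
         ⇔ (a ≤ toℕ p × toℕ p < a + m))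
    × ((blk (proj₁ (lookup (annot T) p)) ≡ β × proj₂ (lookup (annot T) p) ≡ 1)
         ⇔ (a + m ≤ toℕ p × toℕ p < a + m + m′))

KRegInterleaving : ∀ {s} → ℕ → Seq s → Set
KRegInterleaving k S =
  ∀ (i j : ℕ) → i < k → j < k → ¬ (i ≡ j) → TwoRegInterleaving (read2 i j S)

module Submission where

-- Fix two occurrence indices lo < hi < k.  By per-read monotonicity the reads
-- S^{(lo)} and S^{(hi)} traverse the elements either in the same or in opposite
-- directions.  In opposite directions every lo-th occurrence already precedes every
-- hi-th occurrence, so one block shows that S^{(lo,hi)} is 2-regularly interleaving.
-- In the same direction we segment S^{(lo)} greedily: an element opens a new block
-- when the hi-th occurrence of the current block leader precedes its lo-th occurrence.
-- Blocks whose numbers differ by two are then completely separated, so on the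
-- elements whose block number has a fixed parity, the key 2·block + (0 or 1 for a
-- lo-th or hi-th occurrence) is nondecreasing along S^{(lo,hi)}; sorted keys give the
-- intervals required by 2-regular interleaving.  Choosing a majority parity for each
-- of the k² pairs (lo , hi) keeps at least s / 2^{k²} ≥ s / 3^{k²} elements, and
-- restriction preserves the order of the remaining occurrences and hence
-- per-read monotonicity.

open import Defs
open import Data.Nat as ℕ using (ℕ; zero; suc; _+_; _*_; _^_; _∸_; _<_; _≤_; _<?_; z≤n; s≤s)
import Data.Nat.Properties as ℕP
open import Data.Nat.DivMod using (_%_; m<n⇒m%n≡m; [m+kn]%n≡m%n)
open import Data.Fin as Fin using (Fin; toℕ) renaming (_≟_ to _≟F_)
open import Data.Fin.Subset using (Subset; _∈_; _⊆_; ∣_∣; ⊤)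
open import Data.Fin.Subset.Properties using (_∈?_; ∣⊤∣≡n)
open import Data.Vec.Base using ([]; _∷_; here; there)
open import Data.List using (List; []; _∷_; _++_; map; filter; length; lookup; upTo; cartesianProduct)
import Data.List.Properties as LP
open import Data.List.Relation.Unary.All as All using (All; []; _∷_)
import Data.List.Relation.Unary.All.Properties as AllP
open import Data.List.Relation.Unary.Any using (here; there)
open import Data.List.Relation.Unary.AllPairs as AllPairs using (AllPairs; []; _∷_)
import Data.List.Relation.Unary.AllPairs.Properties as AllPairsP
open import Data.List.Membership.Propositional using () renaming (_∈_ to _∈ˡ_)
import Data.List.Membership.Propositional.Properties as ∈P
open import Data.Product using (_×_; _,_; proj₁; proj₂; map₁; uncurry; Σ-syntax; ∃-syntax)
open import Data.Product.Properties using (≡-dec)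
open import Data.Sum using (_⊎_; inj₁; inj₂; swap)
open import Data.Bool using (Bool; true; false; not; if_then_else_)
open import Data.Bool.Properties using () renaming (_≟_ to _≟B_)
open import Data.Empty using (⊥-elim)
open import Relation.Nullary using (¬_; Dec; yes; no; does)
open import Relation.Nullary.Decidable using (⌊_⌋; dec-true; dec-false)
open import Relation.Unary using (Pred; Decidable)
open import Relation.Binary using (tri<; tri≈; tri>)
open import Relation.Binary.Definitions using (DecidableEquality)
open import Relation.Binary.PropositionalEquality
open import Function using (_∘_; _∘′_; id; flip)
open import Function.Bundles using (_⇔_; mk⇔; Equivalence)
open import Function.Construct.Composition using (_⇔-∘_)

filter-map : ∀ {a b p} {A : Set a} {B : Set b} {Q : Pred B p} (Q? : Decidable Q) (f : A → B) (xs : List A) →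
  filter Q? (map f xs) ≡ map f (filter (Q? ∘ f) xs)
filter-map Q? f [] = refl
filter-map Q? f (x ∷ xs) with does (Q? (f x))
... | true  = cong (f x ∷_) (filter-map Q? f xs)
... | false = filter-map Q? f xs

module _ {a} {A : Set a} where

  filter-swap : ∀ {p q} {P : Pred A p} {Q : Pred A q} (P? : Decidable P) (Q? : Decidable Q) (xs : List A) →
    filter P? (filter Q? xs) ≡ filter Q? (filter P? xs)
  filter-swap P? Q? [] = refl
  filter-swap P? Q? (x ∷ xs) with does (P? x) in p | does (Q? x) in q
  ... | true  | true  rewrite p | q = cong (x ∷_) (filter-swap P? Q? xs)
  ... | true  | false rewrite q = filter-swap P? Q? xs
  ... | false | true  rewrite p = filter-swap P? Q? xs
  ... | false | false = filter-swap P? Q? xs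

  AllPairs-weaken : ∀ {r r′} {R : A → A → Set r} {R′ : A → A → Set r′} {xs : List A} →
    (∀ {x y} → x ∈ˡ xs → y ∈ˡ xs → R x y → R′ x y) → AllPairs R xs → AllPairs R′ xs
  AllPairs-weaken h [] = []
  AllPairs-weaken h (rx ∷ rxs) =
    All.tabulate (λ y∈ → h (here refl) (there y∈) (All.lookup rx y∈))
      ∷ AllPairs-weaken (λ u v → h (there u) (there v)) rxs

  AllPairs-compare : ∀ {r} {R : A → A → Set r} {xs : List A} → AllPairs R xs →
    ∀ {x y} → x ∈ˡ xs → y ∈ˡ xs → x ≡ y ⊎ R x y ⊎ R y x
  AllPairs-compare (rx ∷ rxs) (here refl) (here refl) = inj₁ refl
  AllPairs-compare (rx ∷ rxs) (here refl) (there v)   = inj₂ (inj₁ (All.lookup rx v))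
  AllPairs-compare (rx ∷ rxs) (there u)   (here refl) = inj₂ (inj₂ (All.lookup rx u))
  AllPairs-compare (rx ∷ rxs) (there u)   (there v)   = AllPairs-compare rxs u v

  module Position (_≟_ : DecidableEquality A) where

    indexOf : List A → A → ℕ
    indexOf []       x = 0
    indexOf (y ∷ ys) x = if does (x ≟ y) then 0 else suc (indexOf ys x)

    indexOf-injective : ∀ {xs x y} → x ∈ˡ xs → y ∈ˡ xs → indexOf xs x ≡ indexOf xs y → x ≡ y
    indexOf-injective {z ∷ zs} {x} {y} x∈ y∈ eq with x ≟ z | y ≟ z
    indexOf-injective _           _           eq  | yes x≡z | yes y≡z = trans x≡z (sym y≡z)
    indexOf-injective (here x≡z)  _           _   | no x≢z  | _       = ⊥-elim (x≢z x≡z)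
    indexOf-injective _           (here y≡z)  _   | _       | no y≢z  = ⊥-elim (y≢z y≡z)
    indexOf-injective (there x∈)  (there y∈)  eq  | no _    | no _    =
      indexOf-injective x∈ y∈ (ℕP.suc-injective eq)

    indexOf-there : ∀ {y x} ys → ¬ x ≡ y → indexOf (y ∷ ys) x ≡ suc (indexOf ys x)
    indexOf-there {y} {x} ys x≢y with x ≟ y
    ... | yes x≡y = ⊥-elim (x≢y x≡y)
    ... | no _    = refl

    indexOf-increasing : ∀ {xs} → AllPairs (λ x y → ¬ x ≡ y) xs →
      AllPairs (λ x y → indexOf xs x < indexOf xs y) xs
    indexOf-increasing {[]} [] = []
    indexOf-increasing {y ∷ ys} (y≢ ∷ distinct) =
      All.tabulate (λ z∈ → head-first (All.lookup y≢ z∈))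
        ∷ AllPairs-weaken (λ u∈ v∈ lt → subst₂ _<_ (sym (indexOf-there ys (differs-from-head u∈)))
                                                  (sym (indexOf-there ys (differs-from-head v∈))) (s≤s lt))
                          (indexOf-increasing distinct)
      where
      differs-from-head : ∀ {z} → z ∈ˡ ys → ¬ z ≡ y
      differs-from-head z∈ z≡y = All.lookup y≢ z∈ (sym z≡y)
      head-first : ∀ {z} → ¬ y ≡ z → indexOf (y ∷ ys) y < indexOf (y ∷ ys) z
      head-first {z} y≢z with y ≟ y
      ... | no y≢y = ⊥-elim (y≢y refl)
      ... | yes _ rewrite indexOf-there {y} {z} ys (λ z≡y → y≢z (sym z≡y)) = s≤s z≤n

-- rank f c is the number of n < c with f n ≡ true.  After filtering an
-- annotated sequence, the new occurrence index of an entry is such a rank.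
rank : (ℕ → Bool) → ℕ → ℕ
rank f zero    = zero
rank f (suc c) = if f 0 then suc (rank (f ∘ suc) c) else rank (f ∘ suc) c

rank-all : ∀ {f : ℕ → Bool} → (∀ n → f n ≡ true) → ∀ c → rank f c ≡ c
rank-all all-true zero = refl
rank-all {f} all-true (suc c) rewrite all-true 0 = cong suc (rank-all {f ∘ suc} (all-true ∘ suc) c)

rank-none : ∀ {f : ℕ → Bool} c → (∀ n → n < c → f n ≡ false) → rank f c ≡ 0
rank-none zero none = refl
rank-none {f} (suc c) none rewrite none 0 (s≤s z≤n) =
  rank-none {f ∘ suc} c (λ n n<c → none (suc n) (s≤s n<c))

rank-single : ∀ {f : ℕ → Bool} m c → m < c → f m ≡ true →
  (∀ n → n < c → ¬ n ≡ m → f n ≡ false) → rank f c ≡ 1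
rank-single {f} zero (suc c) _ fm only rewrite fm =
  cong suc (rank-none {f ∘ suc} c (λ n n<c → only (suc n) (s≤s n<c) (λ ())))
rank-single {f} (suc m) (suc c) (s≤s m<c) fm only rewrite only 0 (s≤s z≤n) (λ ()) =
  rank-single {f ∘ suc} m c m<c fm (λ n n<c n≢m → only (suc n) (s≤s n<c) (n≢m ∘ ℕP.suc-injective))

-- An entry of an annotated sequence: an element together with its occurrence index.
Occ : ℕ → Set
Occ s = Fin s × ℕ

_≟O_ : ∀ {s} → DecidableEquality (Occ s)
_≟O_ = ≡-dec _≟F_ ℕ._≟_

-- Prepending x to a sequence increments the occurrence indices of x.
bump : ∀ {s} → Fin s → Occ s → Occ s
bump x p = (proj₁ p , (if ⌊ proj₁ p ≟F x ⌋ then suc (proj₂ p) else proj₂ p))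

bump-self : ∀ {s} (x : Fin s) c → bump x (x , c) ≡ (x , suc c)
bump-self x c with x ≟F x
... | yes _  = refl
... | no x≢x = ⊥-elim (x≢x refl)

bump-other : ∀ {s} {x y : Fin s} c → ¬ y ≡ x → bump x (y , c) ≡ (y , c)
bump-other {x = x} {y} c y≢x with y ≟F x
... | yes y≡x = ⊥-elim (y≢x y≡x)
... | no _    = refl

erase-annot : ∀ {s} (S : Seq s) → map proj₁ (annot S) ≡ S
erase-annot []       = refl
erase-annot (x ∷ xs) = cong (x ∷_) (trans (sym (LP.map-∘ (annot xs))) (erase-annot xs))

-- The occurrence index an entry receives when only the entries satisfying Q are kept.
renumber : ∀ {s q} {Q : Pred (Occ s) q} → Decidable Q → Occ s → Occ s
renumber Q? (y , c) = (y , rank (λ c′ → does (Q? (y , c′))) c)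

module _ {s q} {Q : Pred (Occ s) q} (Q? : Decidable Q) (x : Fin s) where

  renumber-bump-kept : does (Q? (x , 0)) ≡ true →
    ∀ e → bump x (renumber (Q? ∘ bump x) e) ≡ renumber Q? (bump x e)
  renumber-bump-kept kept (y , c) with y ≟F x
  ... | no _     = refl
  ... | yes refl = cong (x ,_) (sym step)
    where
    step : rank (λ c′ → does (Q? (x , c′))) (suc c) ≡ suc (rank (λ c′ → does (Q? (x , suc c′))) c)
    step rewrite kept = refl

  renumber-bump-dropped : does (Q? (x , 0)) ≡ false →
    ∀ e → renumber (Q? ∘ bump x) e ≡ renumber Q? (bump x e)
  renumber-bump-dropped dropped (y , c) with y ≟F x
  ... | no _     = refl
  ... | yes refl = cong (x ,_) (sym step)
    where
    step : rank (λ c′ → does (Q? (x , c′))) (suc c) ≡ rank (λ c′ → does (Q? (x , suc c′))) c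
    step rewrite dropped = refl

  erase-filter-bump : ∀ l → map proj₁ (filter Q? (map (bump x) l)) ≡ map proj₁ (filter (Q? ∘ bump x) l)
  erase-filter-bump l = trans (cong (map proj₁) (filter-map Q? (bump x) l)) (sym (LP.map-∘ _))

-- Annotating a filtered annotated sequence renumbers the kept entries by rank.
-- This covers both S|_{X'} and S^{(i,j)}.
annot-filter : ∀ {s q} {Q : Pred (Occ s) q} (Q? : Decidable Q) (S : Seq s) →
  annot (map proj₁ (filter Q? (annot S))) ≡ map (renumber Q?) (filter Q? (annot S))
annot-filter Q? [] = refl
annot-filter Q? (x ∷ xs) with does (Q? (x , 0)) in x-kept
... | true = begin
  annot (x ∷ map proj₁ (filter Q? (map (bump x) (annot xs))))
    ≡⟨ cong (λ l → annot (x ∷ l)) (erase-filter-bump Q? x (annot xs)) ⟩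
  (x , 0) ∷ map (bump x) (annot (map proj₁ (filter Q′ (annot xs))))
    ≡⟨ cong (λ l → (x , 0) ∷ map (bump x) l) (annot-filter Q′ xs) ⟩
  (x , 0) ∷ map (bump x) (map (renumber Q′) (filter Q′ (annot xs)))
    ≡⟨ cong ((x , 0) ∷_) (trans (sym (LP.map-∘ _))
                        (trans (LP.map-cong (renumber-bump-kept Q? x x-kept) _) (LP.map-∘ _))) ⟩
  (x , 0) ∷ map (renumber Q?) (map (bump x) (filter Q′ (annot xs)))
    ≡⟨ cong (λ l → (x , 0) ∷ map (renumber Q?) l) (sym (filter-map Q? (bump x) (annot xs))) ⟩
  (x , 0) ∷ map (renumber Q?) (filter Q? (map (bump x) (annot xs))) ∎
  where
  open ≡-Reasoning
  Q′ = Q? ∘ bump x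
... | false = begin
  annot (map proj₁ (filter Q? (map (bump x) (annot xs))))
    ≡⟨ cong annot (erase-filter-bump Q? x (annot xs)) ⟩
  annot (map proj₁ (filter Q′ (annot xs)))
    ≡⟨ annot-filter Q′ xs ⟩
  map (renumber Q′) (filter Q′ (annot xs))
    ≡⟨ trans (LP.map-cong (renumber-bump-dropped Q? x x-kept) _) (LP.map-∘ _) ⟩
  map (renumber Q?) (map (bump x) (filter Q′ (annot xs)))
    ≡⟨ cong (map (renumber Q?)) (sym (filter-map Q? (bump x) (annot xs))) ⟩
  map (renumber Q?) (filter Q? (map (bump x) (annot xs))) ∎
  where
  open ≡-Reasoning
  Q′ = Q? ∘ bump x

annot-complete : ∀ {s} (S : Seq s) x c → c < occurrences x S → (x , c) ∈ˡ annot S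
annot-complete (y ∷ ys) x c c<occ with x ≟F y
annot-complete (y ∷ ys) x zero    _           | yes refl = here refl
annot-complete (y ∷ ys) x (suc c) (s≤s c<occ) | yes refl =
  there (subst (_∈ˡ map (bump x) (annot ys)) (bump-self x c) (∈P.∈-map⁺ (bump x) (annot-complete ys x c c<occ)))
... | no x≢y =
  there (subst (_∈ˡ map (bump y) (annot ys)) (bump-other c x≢y) (∈P.∈-map⁺ (bump y) (annot-complete ys x c c<occ)))

EarlierOccurrence : ∀ {s} → Occ s → Occ s → Set
EarlierOccurrence a b = proj₁ a ≡ proj₁ b → proj₂ a < proj₂ b

annot-increasing : ∀ {s} (S : Seq s) → AllPairs EarlierOccurrence (annot S)
annot-increasing [] = []
annot-increasing (y ∷ ys) =
  AllP.map⁺ (All.tabulate (λ {e} _ → first e))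
    ∷ AllPairsP.map⁺ (AllPairs.map (λ {a} {b} → bumped a b) (annot-increasing ys))
  where
  first : ∀ e → y ≡ proj₁ e → 0 < proj₂ (bump y e)
  first (z , c) refl with z ≟F z
  ... | yes _  = s≤s z≤n
  ... | no z≢z = ⊥-elim (z≢z refl)
  bumped : ∀ a b → EarlierOccurrence a b → EarlierOccurrence (bump y a) (bump y b)
  bumped (z , c) (z′ , c′) earlier refl with z ≟F y
  ... | yes _ = s≤s (earlier refl)
  ... | no _  = earlier refl

annot-distinct : ∀ {s} (S : Seq s) → AllPairs (λ a b → ¬ a ≡ b) (annot S)
annot-distinct S =
  AllPairs.map (λ earlier a≡b → ℕP.<-irrefl (cong proj₂ a≡b) (earlier (cong proj₁ a≡b))) (annot-increasing S)

-- In a list sorted by a natural-number key, every level set of the key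
-- occupies an interval of positions, delimited by the counts of smaller keys.
module SortedByKey {a} {A : Set a} (key : A → ℕ) where

  countBelow : ℕ → List A → ℕ
  countBelow v xs = length (filter (λ e → key e <? v) xs)

  countBelow-keep : ∀ {v e} xs → key e < v → countBelow v (e ∷ xs) ≡ suc (countBelow v xs)
  countBelow-keep {v} xs ev = cong length (LP.filter-accept (λ e → key e <? v) {xs = xs} ev)

  countBelow-skip : ∀ {v e} xs → ¬ key e < v → countBelow v (e ∷ xs) ≡ countBelow v xs
  countBelow-skip {v} xs ¬ev = cong length (LP.filter-reject (λ e → key e <? v) {xs = xs} ¬ev)

  countBelow-mono : ∀ {v w} xs → v ≤ w → countBelow v xs ≤ countBelow w xs
  countBelow-mono [] _ = z≤n
  countBelow-mono {v} {w} (e ∷ xs) v≤w with key e <? v | key e <? w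
  ... | yes ev | yes ew rewrite countBelow-keep xs ev | countBelow-keep xs ew = s≤s (countBelow-mono xs v≤w)
  ... | yes ev | no ¬ew = ⊥-elim (¬ew (ℕP.<-≤-trans ev v≤w))
  ... | no ¬ev | yes ew rewrite countBelow-skip xs ¬ev | countBelow-keep xs ew =
    ℕP.m≤n⇒m≤1+n (countBelow-mono xs v≤w)
  ... | no ¬ev | no ¬ew rewrite countBelow-skip xs ¬ev | countBelow-skip xs ¬ew = countBelow-mono xs v≤w

  Sorted : List A → Set a
  Sorted = AllPairs (λ x y → key x ≤ key y)

  below-prefix : ∀ {xs} → Sorted xs → ∀ v (p : Fin (length xs)) →
    key (lookup xs p) < v ⇔ toℕ p < countBelow v xs
  below-prefix {e ∷ xs} (e≤ ∷ sorted) v p with key e <? v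
  below-prefix {e ∷ xs} (e≤ ∷ sorted) v Fin.zero    | yes ev rewrite countBelow-keep xs ev =
    mk⇔ (λ _ → s≤s z≤n) (λ _ → ev)
  below-prefix {e ∷ xs} (e≤ ∷ sorted) v (Fin.suc p) | yes ev rewrite countBelow-keep xs ev =
    mk⇔ (s≤s ∘′ to) (from ∘′ ℕP.≤-pred) where open Equivalence (below-prefix sorted v p)
  below-prefix {e ∷ xs} (e≤ ∷ sorted) v p | no ¬ev =
    mk⇔ (λ below → ⊥-elim (¬ev (ℕP.≤-<-trans (key-e≤ p) below)))
        (λ p<n → ⊥-elim (ℕP.n≮0 (subst (toℕ p <_) (trans (countBelow-skip xs ¬ev) none-below) p<n)))
    where
    key-e≤ : ∀ p → key e ≤ key (lookup (e ∷ xs) p)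
    key-e≤ Fin.zero    = ℕP.≤-refl
    key-e≤ (Fin.suc p) = All.lookup e≤ (∈P.∈-lookup p)
    none-below : countBelow v xs ≡ 0
    none-below = cong length (LP.filter-none (λ e → key e <? v)
                   (All.map (λ e≤x x<v → ¬ev (ℕP.≤-<-trans e≤x x<v)) e≤))

  level-interval : ∀ {xs} → Sorted xs → ∀ v (p : Fin (length xs)) →
    key (lookup xs p) ≡ v ⇔ (countBelow v xs ≤ toℕ p × toℕ p < countBelow (suc v) xs)
  level-interval {xs} sorted v p = mk⇔ to from
    where
    module Below = Equivalence (below-prefix sorted v p)
    module Below′ = Equivalence (below-prefix sorted (suc v) p)
    to : key (lookup xs p) ≡ v → countBelow v xs ≤ toℕ p × toℕ p < countBelow (suc v) xs
    to refl = ℕP.≮⇒≥ (ℕP.<-irrefl refl ∘′ Below.from) , Below′.to ℕP.≤-refl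
    from : countBelow v xs ≤ toℕ p × toℕ p < countBelow (suc v) xs → key (lookup xs p) ≡ v
    from (lo , hi) =
      ℕP.≤-antisym (ℕP.≤-pred (Below′.from hi)) (ℕP.≮⇒≥ (λ below → ℕP.<⇒≱ (Below.to below) lo))

digits-injective : ∀ {b b′ c c′} → c < 2 → c′ < 2 → c + b * 2 ≡ c′ + b′ * 2 → b ≡ b′ × c ≡ c′
digits-injective {b} {b′} {c} {c′} c<2 c′<2 eq = b≡b′ , c≡c′
  where
  open ≡-Reasoning
  c≡c′ : c ≡ c′
  c≡c′ = begin
    c                ≡⟨ m<n⇒m%n≡m c<2 ⟨
    c % 2            ≡⟨ [m+kn]%n≡m%n c b 2 ⟨
    (c + b * 2) % 2  ≡⟨ cong (_% 2) eq ⟩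
    (c′ + b′ * 2) % 2 ≡⟨ [m+kn]%n≡m%n c′ b′ 2 ⟩
    c′ % 2           ≡⟨ m<n⇒m%n≡m c′<2 ⟩
    c′               ∎
  b≡b′ : b ≡ b′
  b≡b′ = ℕP.*-cancelʳ-≡ b b′ 2
           (ℕP.+-cancelˡ-≡ c (b * 2) (b′ * 2) (trans eq (cong (_+ b′ * 2) (sym c≡c′))))

-- The sorting key of an entry of a read-2 sequence, given a block assignment:
-- blocks in increasing order, first occurrences of a block before its second ones.
blockKey : ∀ {s} → (Fin s → ℕ) → Occ s → ℕ
blockKey blk (x , c) = c + blk x * 2

twoReg-from-sorted-keys : ∀ {s} (T : Seq s) (blk : Fin s → ℕ) →
  All (λ e → proj₂ e < 2) (annot T) →
  AllPairs (λ e e′ → blockKey blk e ≤ blockKey blk e′) (annot T) →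
  TwoRegInterleaving T
twoReg-from-sorted-keys T blk read2 sorted = blk , λ β →
  start β , middle β ∸ start β , end β ∸ middle β ,
  λ p → subst (λ n → InBlock β 0 p ⇔ (start β ≤ toℕ p × toℕ p < n)) (sym (reaches-middle β))
              (block-level β 0 (s≤s z≤n) p)
      , subst₂ (λ m n → InBlock β 1 p ⇔ (m ≤ toℕ p × toℕ p < n)) (sym (reaches-middle β)) (sym (reaches-end β))
               (block-level β 1 (s≤s (s≤s z≤n)) p)
  where
  L = annot T
  open SortedByKey (blockKey blk)
  -- block β occupies [start β, middle β) with first and [middle β, end β) with second occurrences
  start middle end : ℕ → ℕ
  start  β = countBelow (β * 2) L
  middle β = countBelow (1 + β * 2) L
  end    β = countBelow (2 + β * 2) L
  reaches-middle : ∀ β → start β + (middle β ∸ start β) ≡ middle β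
  reaches-middle β = ℕP.m+[n∸m]≡n (countBelow-mono L (ℕP.n≤1+n _))
  reaches-end : ∀ β → start β + (middle β ∸ start β) + (end β ∸ middle β) ≡ end β
  reaches-end β = trans (cong (_+ (end β ∸ middle β)) (reaches-middle β))
                        (ℕP.m+[n∸m]≡n (countBelow-mono L (ℕP.n≤1+n _)))
  InBlock : ℕ → ℕ → Fin (length L) → Set
  InBlock β i p = blk (proj₁ (lookup L p)) ≡ β × proj₂ (lookup L p) ≡ i
  block-level : ∀ β i → i < 2 → ∀ p →
    InBlock β i p ⇔ (countBelow (i + β * 2) L ≤ toℕ p × toℕ p < countBelow (suc (i + β * 2)) L)
  block-level β i i<2 p = level-interval sorted (i + β * 2) p ⇔-∘ decode
    where
    decode : InBlock β i p ⇔ (blockKey blk (lookup L p) ≡ i + β * 2)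
    decode = mk⇔ (λ { (refl , refl) → refl }) (digits-injective (All.lookup read2 (∈P.∈-lookup p)) i<2)

-- For a list sorted by a
-- relation _≺_ along which cuts persist to the right (cut-right) and to the left
-- (cut-left), block numbers are monotone, every cut increases the block number, and
-- elements whose blocks are two or more apart are always cut (see Properties).
module Segmentation {E : Set} (_≟_ : DecidableEquality E) (Cut : E → E → Set) (Cut? : ∀ a b → Dec (Cut a b)) where

  mutual
    segment : E → ℕ → List E → List (E × ℕ)
    segment ℓ t []       = []
    segment ℓ t (b ∷ bs) = if does (Cut? ℓ b) then leading b (suc t) bs else (b , t) ∷ segment ℓ t bs

    leading : E → ℕ → List E → List (E × ℕ)
    leading b t bs = (b , t) ∷ segment b t bs

  segmentation : List E → List (E × ℕ)
  segmentation []       = []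
  segmentation (b ∷ bs) = leading b 0 bs

  numberOf : List (E × ℕ) → E → ℕ
  numberOf []             x = 0
  numberOf ((y , t) ∷ ys) x = if does (x ≟ y) then t else numberOf ys x

  numberOf-∈ : ∀ {ys x t} → AllPairs (λ p q → ¬ proj₁ p ≡ proj₁ q) ys → (x , t) ∈ˡ ys → numberOf ys x ≡ t
  numberOf-∈ {x = x} (_ ∷ _) (here refl) with x ≟ x
  ... | yes _  = refl
  ... | no x≢x = ⊥-elim (x≢x refl)
  numberOf-∈ {(y , _) ∷ _} {x} (y≢ ∷ distinct) (there x∈) with x ≟ y
  ... | yes refl = ⊥-elim (All.lookup y≢ x∈ refl)
  ... | no _     = numberOf-∈ distinct x∈

  block : List E → E → ℕ
  block O = numberOf (segmentation O)

  module Properties (_≺_ : E → E → Set)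
                    (cut-right : ∀ {ℓ b b′} → Cut ℓ b → b ≺ b′ → Cut ℓ b′)
                    (cut-left : ∀ {a b b′} → a ≺ b → Cut b b′ → Cut a b′) where

    mutual
      erase-segment : ∀ ℓ t bs → map proj₁ (segment ℓ t bs) ≡ bs
      erase-segment ℓ t [] = refl
      erase-segment ℓ t (b ∷ bs) with Cut? ℓ b
      ... | yes _ = erase-leading b (suc t) bs
      ... | no _  = cong (b ∷_) (erase-segment ℓ t bs)

      erase-leading : ∀ b t bs → map proj₁ (leading b t bs) ≡ b ∷ bs
      erase-leading b t bs = cong (b ∷_) (erase-segment b t bs)

    erase-segmentation : ∀ bs → map proj₁ (segmentation bs) ≡ bs
    erase-segmentation []       = refl
    erase-segmentation (b ∷ bs) = erase-leading b 0 bs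

    mutual
      segment-≥ : ∀ ℓ t bs → All (λ q → t ≤ proj₂ q) (segment ℓ t bs)
      segment-≥ ℓ t [] = []
      segment-≥ ℓ t (b ∷ bs) with Cut? ℓ b
      ... | yes _ = All.map (ℕP.≤-trans (ℕP.n≤1+n t)) (leading-≥ b (suc t) bs)
      ... | no _  = ℕP.≤-refl ∷ segment-≥ ℓ t bs

      leading-≥ : ∀ b t bs → All (λ q → t ≤ proj₂ q) (leading b t bs)
      leading-≥ b t bs = ℕP.≤-refl ∷ segment-≥ b t bs

    segment-cut-later : ∀ ℓ t bs → All (λ q → Cut ℓ (proj₁ q) → t < proj₂ q) (segment ℓ t bs)
    segment-cut-later ℓ t [] = []
    segment-cut-later ℓ t (b ∷ bs) with Cut? ℓ b
    ... | yes _  = All.map (λ t< _ → t<) (leading-≥ b (suc t) bs)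
    ... | no ¬ℓb = (λ ℓb → ⊥-elim (¬ℓb ℓb)) ∷ segment-cut-later ℓ t bs

    segment-later-cut : ∀ ℓ t bs → AllPairs _≺_ bs →
      All (λ q → t < proj₂ q → Cut ℓ (proj₁ q)) (segment ℓ t bs)
    segment-later-cut ℓ t [] _ = []
    segment-later-cut ℓ t (b ∷ bs) (b≺ ∷ sorted) with Cut? ℓ b
    ... | yes ℓb = All.map (λ cut _ → cut) (AllP.map⁻ (subst (All (Cut ℓ)) (sym (erase-leading b (suc t) bs))
                                                              (ℓb ∷ All.map (cut-right ℓb) b≺)))
    ... | no _   = (λ t<t → ⊥-elim (ℕP.<-irrefl refl t<t)) ∷ segment-later-cut ℓ t bs sorted

    segment-far-cut : ∀ ℓ t bs → AllPairs _≺_ bs → ∀ {a} → All (a ≺_) bs →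
      All (λ q → suc t < proj₂ q → Cut a (proj₁ q)) (segment ℓ t bs)
    segment-far-cut ℓ t [] _ _ = []
    segment-far-cut ℓ t (b ∷ bs) (b≺ ∷ sorted) (a≺b ∷ a≺) with Cut? ℓ b
    ... | yes _ = (λ lt → ⊥-elim (ℕP.<-irrefl refl lt))
                    ∷ All.map (λ cut lt → cut-left a≺b (cut lt)) (segment-later-cut b (suc t) bs sorted)
    ... | no _  = (λ lt → ⊥-elim (ℕP.<-asym lt (ℕP.n<1+n t))) ∷ segment-far-cut ℓ t bs sorted a≺

    BlockOrder : E × ℕ → E × ℕ → Set
    BlockOrder (x , i) (y , j) = i ≤ j × (Cut x y → i < j) × (suc i < j → Cut x y)

    mutual
      leading-ordered : ∀ b t bs → All (b ≺_) bs → AllPairs _≺_ bs → AllPairs BlockOrder (leading b t bs)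
      leading-ordered b t bs b≺ sorted =
        All.zip (segment-≥ b t bs , All.zip (segment-cut-later b t bs ,
          All.map (λ cut lt → cut (ℕP.<-trans (ℕP.n<1+n t) lt)) (segment-later-cut b t bs sorted)))
        ∷ segment-ordered b t bs b≺ sorted

      segment-ordered : ∀ ℓ t bs → All (ℓ ≺_) bs → AllPairs _≺_ bs → AllPairs BlockOrder (segment ℓ t bs)
      segment-ordered ℓ t [] _ _ = []
      segment-ordered ℓ t (b ∷ bs) (ℓ≺b ∷ ℓ≺) (b≺ ∷ sorted) with Cut? ℓ b
      ... | yes _ = leading-ordered b (suc t) bs b≺ sorted
      ... | no _  =
        All.zip (segment-≥ ℓ t bs ,
          All.zip (All.map (λ later cut → later (cut-left ℓ≺b cut)) (segment-cut-later ℓ t bs) ,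
                   segment-far-cut ℓ t bs sorted b≺))
        ∷ segment-ordered ℓ t bs ℓ≺ sorted

    segmentation-ordered : ∀ bs → AllPairs _≺_ bs → AllPairs BlockOrder (segmentation bs)
    segmentation-ordered []       _              = []
    segmentation-ordered (b ∷ bs) (b≺ ∷ sorted) = leading-ordered b 0 bs b≺ sorted

    module Blocks (O : List E) (sorted : AllPairs _≺_ O)
                  (≺-irrefl : ∀ {x} → ¬ x ≺ x) (≺-asym : ∀ {x y} → x ≺ y → ¬ y ≺ x) where

      private
        leaders-sorted : AllPairs (λ p q → proj₁ p ≺ proj₁ q) (segmentation O)
        leaders-sorted = AllPairsP.map⁻ (subst (AllPairs _≺_) (sym (erase-segmentation O)) sorted)

        leaders-distinct : AllPairs (λ p q → ¬ proj₁ p ≡ proj₁ q) (segmentation O)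
        leaders-distinct = AllPairs.map (λ x≺y x≡y → ≺-irrefl (subst (_≺ _) x≡y x≺y)) leaders-sorted

        numbered : ∀ {x} → x ∈ˡ O → (x , block O x) ∈ˡ segmentation O
        numbered {x} x∈ with ∈P.∈-map⁻ proj₁ (subst (x ∈ˡ_) (sym (erase-segmentation O)) x∈)
        ... | (_ , t) , x∈′ , refl =
          subst (λ u → (x , u) ∈ˡ segmentation O) (sym (numberOf-∈ leaders-distinct x∈′)) x∈′

      block-order : ∀ {x y} → x ∈ˡ O → y ∈ˡ O → x ≺ y → BlockOrder (x , block O x) (y , block O y)
      block-order x∈ y∈ x≺y with AllPairs-compare (AllPairs.zip (leaders-sorted , segmentation-ordered O sorted))
                                                  (numbered x∈) (numbered y∈)
      ... | inj₁ refl              = ⊥-elim (≺-irrefl x≺y)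
      ... | inj₂ (inj₁ (_ , ord))  = ord
      ... | inj₂ (inj₂ (y≺x , _))  = ⊥-elim (≺-asym x≺y y≺x)

colourClass : ∀ {n} → Subset n → (Fin n → Bool) → Bool → Subset n
colourClass []          f b = []
colourClass (false ∷ Y) f b = false ∷ colourClass Y (f ∘ Fin.suc) b
colourClass (true ∷ Y)  f b = does (f Fin.zero ≟B b) ∷ colourClass Y (f ∘ Fin.suc) b

colourClass-sound : ∀ {n} (Y : Subset n) f b {x} → x ∈ colourClass Y f b → x ∈ Y × f x ≡ b
colourClass-sound (true ∷ Y) f b {Fin.zero} x∈ with f Fin.zero ≟B b | x∈
... | yes fx≡b | _ = here , fx≡b
colourClass-sound (true ∷ Y)  f b {Fin.suc x} (there x∈) =
  map₁ there (colourClass-sound Y (f ∘ Fin.suc) b x∈)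
colourClass-sound (false ∷ Y) f b {Fin.suc x} (there x∈) =
  map₁ there (colourClass-sound Y (f ∘ Fin.suc) b x∈)

colourClass-split : ∀ {n} (Y : Subset n) f → ∣ colourClass Y f true ∣ + ∣ colourClass Y f false ∣ ≡ ∣ Y ∣
colourClass-split []          f = refl
colourClass-split (false ∷ Y) f = colourClass-split Y (f ∘ Fin.suc)
colourClass-split (true ∷ Y)  f with f Fin.zero
... | true  = cong suc (colourClass-split Y (f ∘ Fin.suc))
... | false = trans (ℕP.+-suc _ _) (cong suc (colourClass-split Y (f ∘ Fin.suc)))

majorityColour : ∀ {n} (Y : Subset n) f → Σ[ b ∈ Bool ] ∣ Y ∣ ≤ 2 * ∣ colourClass Y f b ∣
majorityColour Y f with ℕP.≤-total ∣ colourClass Y f false ∣ ∣ colourClass Y f true ∣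
... | inj₁ F≤T = true , subst (_≤ 2 * ∣ colourClass Y f true ∣) (colourClass-split Y f)
                          (ℕP.+-monoʳ-≤ ∣ colourClass Y f true ∣ (ℕP.≤-trans F≤T (ℕP.m≤m+n _ 0)))
... | inj₂ T≤F = false , subst (_≤ 2 * ∣ colourClass Y f false ∣) (colourClass-split Y f)
                           (ℕP.+-mono-≤ T≤F (ℕP.m≤m+n _ 0))

Monochromatic : ∀ {n} → Subset n → (Fin n → Bool) → Set
Monochromatic Z f = ∀ {x y} → x ∈ Z → y ∈ Z → f x ≡ f y

monochromatic-subset : ∀ {n} (fs : List (Fin n → Bool)) (Y : Subset n) →
  Σ[ Z ∈ Subset n ] (Z ⊆ Y × ∣ Y ∣ ≤ 2 ^ length fs * ∣ Z ∣ × All (Monochromatic Z) fs)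
monochromatic-subset []       Y = Y , id , ℕP.≤-reflexive (sym (ℕP.+-identityʳ ∣ Y ∣)) , []
monochromatic-subset (f ∷ fs) Y with majorityColour Y f
... | b , Y≤2C with monochromatic-subset fs (colourClass Y f b)
...   | Z , Z⊆C , C≤Z , mono =
  Z , proj₁ ∘ in-class ∘ Z⊆C , bound , f-constant ∷ mono
  where
  in-class = colourClass-sound Y f b
  f-constant : Monochromatic Z f
  f-constant x∈ y∈ = trans (proj₂ (in-class (Z⊆C x∈))) (sym (proj₂ (in-class (Z⊆C y∈))))
  bound : ∣ Y ∣ ≤ 2 ^ length (f ∷ fs) * ∣ Z ∣
  bound = ℕP.≤-trans Y≤2C (ℕP.≤-trans (ℕP.*-monoʳ-≤ 2 C≤Z)
                                      (ℕP.≤-reflexive (sym (ℕP.*-assoc 2 (2 ^ length fs) ∣ Z ∣))))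

parity : ℕ → Bool
parity zero    = false
parity (suc n) = not (parity n)

parity-≤ : ∀ {a b} → parity a ≡ parity b → a ≤ suc b → a ≤ b
parity-≤ {a} {b} same a≤1+b with ℕP.m≤n⇒m<n∨m≡n a≤1+b
... | inj₁ a<1+b = ℕP.≤-pred a<1+b
... | inj₂ refl  = ⊥-elim (not-fixed (parity b) same)
  where
  not-fixed : ∀ x → ¬ not x ≡ x
  not-fixed true  ()
  not-fixed false ()

pairsBelow : ℕ → List (ℕ × ℕ)
pairsBelow k = cartesianProduct (upTo k) (upTo k)

length-cartesianProduct : ∀ {A B : Set} (xs : List A) (ys : List B) →
  length (cartesianProduct xs ys) ≡ length xs * length ys
length-cartesianProduct []       ys = refl
length-cartesianProduct (x ∷ xs) ys = begin
  length (map (x ,_) ys ++ cartesianProduct xs ys)          ≡⟨ LP.length-++ (map (x ,_) ys) ⟩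
  length (map (x ,_) ys) + length (cartesianProduct xs ys)
    ≡⟨ cong₂ _+_ (LP.length-map (x ,_) ys) (length-cartesianProduct xs ys) ⟩
  length ys + length xs * length ys                          ∎
  where open ≡-Reasoning

length-pairsBelow : ∀ k → length (pairsBelow k) ≡ k * k
length-pairsBelow k rewrite length-cartesianProduct (upTo k) (upTo k) | LP.length-upTo k = refl

∈-pairsBelow : ∀ {i j k} → i < k → j < k → (i , j) ∈ˡ pairsBelow k
∈-pairsBelow i<k j<k = ∈P.∈-cartesianProduct⁺ (∈P.∈-upTo⁺ i<k) (∈P.∈-upTo⁺ j<k)

annot-restrict : ∀ {s} (X : Subset s) (S : Seq s) →
  annot (restrict X S) ≡ filter (λ e → proj₁ e ∈? X) (annot S)
annot-restrict X S = begin
  annot (filter (_∈? X) S)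
    ≡⟨ cong (λ T → annot (filter (_∈? X) T)) (sym (erase-annot S)) ⟩
  annot (filter (_∈? X) (map proj₁ (annot S)))
    ≡⟨ cong annot (filter-map (_∈? X) proj₁ (annot S)) ⟩
  annot (map proj₁ (filter inX (annot S)))
    ≡⟨ annot-filter inX S ⟩
  map (renumber inX) (filter inX (annot S))
    ≡⟨ LP.map-id-local (All.tabulate (unchanged ∘ proj₂ ∘ ∈P.∈-filter⁻ inX {xs = annot S})) ⟩
  filter inX (annot S) ∎
  where
  open ≡-Reasoning
  inX = λ (e : Occ _) → proj₁ e ∈? X
  -- all occurrences of a kept element are kept, so its indices do not change
  unchanged : ∀ {e} → proj₁ e ∈ X → renumber inX e ≡ e
  unchanged {x , c} x∈ = cong (x ,_) (rank-all (λ _ → dec-true (x ∈? X) x∈) c)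

read-restrict : ∀ {s} (X : Subset s) (S : Seq s) i → read i (restrict X S) ≡ restrict X (read i S)
read-restrict X S i = begin
  map proj₁ (filter ith (annot (restrict X S)))
    ≡⟨ cong (λ l → map proj₁ (filter ith l)) (annot-restrict X S) ⟩
  map proj₁ (filter ith (filter inX (annot S)))
    ≡⟨ cong (map proj₁) (filter-swap ith inX (annot S)) ⟩
  map proj₁ (filter inX (filter ith (annot S)))
    ≡⟨ filter-map (_∈? X) proj₁ (filter ith (annot S)) ⟨
  filter (_∈? X) (read i S) ∎
  where
  open ≡-Reasoning
  inX = λ (e : Occ _) → proj₁ e ∈? X
  ith = λ (e : Occ _) → proj₂ e ℕ.≟ i

firstPos-restrict : ∀ {s} (X : Subset s) (T : Seq s) {x y} → x ∈ X → y ∈ X →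
  firstPos T x < firstPos T y → firstPos (restrict X T) x < firstPos (restrict X T) y
firstPos-restrict X (z ∷ zs) x∈ y∈ lt with z ∈? X
firstPos-restrict X (z ∷ zs) {x} {y} x∈ y∈ lt | yes _ with x ≟F z | y ≟F z
... | yes _ | yes _ = ⊥-elim (ℕP.n≮0 lt)
... | yes _ | no _  = s≤s z≤n
... | no _  | yes _ = ⊥-elim (ℕP.n≮0 lt)
... | no _  | no _  = s≤s (firstPos-restrict X zs x∈ y∈ (ℕP.≤-pred lt))
firstPos-restrict X (z ∷ zs) {x} {y} x∈ y∈ lt | no z∉ with x ≟F z | y ≟F z
... | yes refl | _        = ⊥-elim (z∉ x∈)
... | no _     | yes refl = ⊥-elim (z∉ y∈)
... | no _     | no _     = firstPos-restrict X zs x∈ y∈ (ℕP.≤-pred lt)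

∈-restrict : ∀ {s} (X : Subset s) (T : Seq s) {a} → a ∈ˡ restrict X T → a ∈ X
∈-restrict X T a∈ = proj₂ (∈P.∈-filter⁻ (_∈? X) {xs = T} a∈)

monotone-restrict : ∀ {s} (X : Subset s) (S : Seq s) i →
  MonotoneIn S (read i S) → MonotoneIn (restrict X S) (read i (restrict X S))
monotone-restrict X S i mono rewrite read-restrict X S i with mono
... | inj₁ increasing = inj₁ (AllPairs-weaken (λ a∈ b∈ → firstPos-restrict X S (kept a∈) (kept b∈))
                                              (AllPairsP.filter⁺ (_∈? X) increasing))
  where kept = ∈-restrict X (read i S)
... | inj₂ decreasing = inj₂ (AllPairs-weaken (λ a∈ b∈ → firstPos-restrict X S (kept b∈) (kept a∈))
                                              (AllPairsP.filter⁺ (_∈? X) decreasing))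
  where kept = ∈-restrict X (read i S)

perReadMonotone-restrict : ∀ {s k} (X : Subset s) (S : Seq s) → PerReadMonotone k S → PerReadMonotone k (restrict X S)
perReadMonotone-restrict X S mono i i<k = monotone-restrict X S i (mono i i<k)

module Main {s k : ℕ} (S : Seq s) (readK : ReadK k S) where

  open Position (_≟O_ {s})

  -- the position in S of an annotated entry; x at c is where the c-th occurrence of x sits
  pos : Occ s → ℕ
  pos = indexOf (annot S)

  _at_ : Fin s → ℕ → ℕ
  x at c = pos (x , c)

  occurrence-∈ : ∀ x {c} → c < k → (x , c) ∈ˡ annot S
  occurrence-∈ x {c} c<k = annot-complete S x c (subst (c <_) (sym (readK x)) c<k)

  pos-increasing : AllPairs (λ e e′ → pos e < pos e′) (annot S)
  pos-increasing = indexOf-increasing (annot-distinct S)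

  -- distinct elements have distinct c-th occurrences
  at-compare : ∀ {c} → c < k → ∀ x y → x at c < y at c ⊎ x ≡ y ⊎ y at c < x at c
  at-compare {c} c<k x y with ℕP.<-cmp (x at c) (y at c)
  ... | tri< lt _ _ = inj₁ lt
  ... | tri≈ _ eq _ = inj₂ (inj₁ (cong proj₁ (indexOf-injective (occurrence-∈ x c<k) (occurrence-∈ y c<k) eq)))
  ... | tri> _ _ gt = inj₂ (inj₂ gt)

  occurrences-ordered : ∀ {lo hi} → lo < hi → hi < k → ∀ x → x at lo < x at hi
  occurrences-ordered lo<hi hi<k x
    with AllPairs-compare (AllPairs.zip (annot-increasing S , pos-increasing))
                          (occurrence-∈ x (ℕP.<-trans lo<hi hi<k)) (occurrence-∈ x hi<k)
  ... | inj₁ eq                   = ⊥-elim (ℕP.<⇒≢ lo<hi (cong proj₂ eq))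
  ... | inj₂ (inj₁ (_ , lt))      = lt
  ... | inj₂ (inj₂ (earlier , _)) = ⊥-elim (ℕP.<-asym lo<hi (earlier refl))

  index-is : ∀ c → Decidable (λ (e : Occ s) → proj₂ e ≡ c)
  index-is c e = proj₂ e ℕ.≟ c

  read-sorted : ∀ c → AllPairs (λ x y → x at c < y at c) (read c S)
  read-sorted c = AllPairsP.map⁺ (AllPairs-weaken at-c (AllPairsP.filter⁺ (index-is c) pos-increasing))
    where
    at-c : ∀ {e e′} → e ∈ˡ filter (index-is c) (annot S) → e′ ∈ˡ filter (index-is c) (annot S) →
           pos e < pos e′ → proj₁ e at c < proj₁ e′ at c
    at-c {e} {e′} e∈ e′∈ = subst₂ (λ i j → proj₁ e at i < proj₁ e′ at j)
                             (proj₂ (∈P.∈-filter⁻ (index-is c) {xs = annot S} e∈))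
                             (proj₂ (∈P.∈-filter⁻ (index-is c) {xs = annot S} e′∈))

  ∈-read : ∀ x {c} → c < k → x ∈ˡ read c S
  ∈-read x c<k = ∈P.∈-map⁺ proj₁ (∈P.∈-filter⁺ (index-is _) (occurrence-∈ x c<k) refl)

  along-read : ∀ {R : Fin s → Fin s → Set} {c} → c < k → AllPairs R (read c S) →
    ∀ {x y} → x at c < y at c → R x y
  along-read c<k sorted {x} {y} lt
    with AllPairs-compare (AllPairs.zip (sorted , read-sorted _)) (∈-read x c<k) (∈-read y c<k)
  ... | inj₁ refl            = ⊥-elim (ℕP.<-irrefl refl lt)
  ... | inj₂ (inj₁ (Rxy , _)) = Rxy
  ... | inj₂ (inj₂ (_ , gt))  = ⊥-elim (ℕP.<-asym lt gt)

  Strict : (Fin s → Fin s → Set) → Set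
  Strict F = (∀ {x} → ¬ F x x) × (∀ {x y} → F x y → ¬ F y x)

  at-reflects : ∀ {F} {c} → c < k → Strict F → AllPairs F (read c S) → ∀ {x y} → F x y → x at c < y at c
  at-reflects c<k (irrefl , asym) sorted {x} {y} Fxy with at-compare c<k x y
  ... | inj₁ lt        = lt
  ... | inj₂ (inj₁ refl) = ⊥-elim (irrefl Fxy)
  ... | inj₂ (inj₂ gt) = ⊥-elim (asym Fxy (along-read c<k sorted gt))

  SameDir OppDir : ℕ → ℕ → Set
  SameDir lo hi = ∀ x y → x at lo < y at lo → x at hi < y at hi
  OppDir  lo hi = ∀ x y → x at lo < y at lo → y at hi < x at hi

  same-order : ∀ {F lo hi} → lo < k → hi < k → Strict F →
    AllPairs F (read lo S) → AllPairs F (read hi S) → SameDir lo hi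
  same-order lo<k hi<k strict lo-sorted hi-sorted x y lt =
    at-reflects hi<k strict hi-sorted (along-read lo<k lo-sorted lt)

  opposite-order : ∀ {F lo hi} → lo < k → hi < k → Strict F →
    AllPairs F (read lo S) → AllPairs (flip F) (read hi S) → OppDir lo hi
  opposite-order lo<k hi<k (irrefl , asym) lo-sorted hi-sorted x y lt =
    at-reflects hi<k (irrefl , flip asym) hi-sorted (along-read lo<k lo-sorted lt)

  FirstBefore : Fin s → Fin s → Set
  FirstBefore x y = firstPos S x < firstPos S y

  firstBefore-strict : Strict FirstBefore
  firstBefore-strict = ℕP.<-irrefl refl , ℕP.<-asym

  firstAfter-strict : Strict (flip FirstBefore)
  firstAfter-strict = ℕP.<-irrefl refl , ℕP.<-asym

  directions : ∀ {lo hi} → lo < k → hi < k → MonotoneIn S (read lo S) → MonotoneIn S (read hi S) →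
    SameDir lo hi ⊎ OppDir lo hi
  directions lo<k hi<k (inj₁ lo-inc) (inj₁ hi-inc) = inj₁ (same-order lo<k hi<k firstBefore-strict lo-inc hi-inc)
  directions lo<k hi<k (inj₂ lo-dec) (inj₂ hi-dec) = inj₁ (same-order lo<k hi<k firstAfter-strict lo-dec hi-dec)
  directions lo<k hi<k (inj₁ lo-inc) (inj₂ hi-dec) = inj₂ (opposite-order lo<k hi<k firstBefore-strict lo-inc hi-dec)
  directions lo<k hi<k (inj₂ lo-dec) (inj₁ hi-inc) = inj₂ (opposite-order lo<k hi<k firstAfter-strict lo-dec hi-inc)

  opposite-separated : ∀ {lo hi} → lo < hi → hi < k → OppDir lo hi → ∀ x y → ¬ x at hi < y at lo
  opposite-separated lo<hi hi<k opp x y hi<lo with at-compare (ℕP.<-trans lo<hi hi<k) x y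
  ... | inj₁ lt        = ℕP.<-asym hi<lo (ℕP.<-trans (occurrences-ordered lo<hi hi<k y) (opp x y lt))
  ... | inj₂ (inj₁ refl) = ℕP.<-asym hi<lo (occurrences-ordered lo<hi hi<k x)
  ... | inj₂ (inj₂ gt) = ℕP.<-asym hi<lo (ℕP.<-trans gt (occurrences-ordered lo<hi hi<k x))

  module Greedy (lo hi : ℕ) = Segmentation _≟F_ (λ ℓ b → ℓ at hi < b at lo) (λ ℓ b → ℓ at hi <? b at lo)

  blockOf : ℕ → ℕ → Fin s → ℕ
  blockOf lo hi = Greedy.block lo hi (read lo S)

  colourings : List (Fin s → Bool)
  colourings = map (uncurry λ lo hi → parity ∘ blockOf lo hi) (pairsBelow k)

  length-colourings : length colourings ≡ k * k
  length-colourings = trans (LP.length-map _ (pairsBelow k)) (length-pairsBelow k)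

  module SameDirection {lo hi} (lo<hi : lo < hi) (hi<k : hi < k) (same : SameDir lo hi) where

    private
      lo<k : lo < k
      lo<k = ℕP.<-trans lo<hi hi<k
      open Greedy lo hi
      open Properties (λ x y → x at lo < y at lo) ℕP.<-trans (λ {a} {b} a≺b cut → ℕP.<-trans (same a b a≺b) cut)
      open Blocks (read lo S) (read-sorted lo) (ℕP.<-irrefl refl) ℕP.<-asym

      g = blockOf lo hi

      order : ∀ {x y} → x at lo < y at lo → BlockOrder (x , g x) (y , g y)
      order {x} {y} = block-order (∈-read x lo<k) (∈-read y lo<k)

    block-mono-lo : ∀ {x y} → x at lo < y at lo → g x ≤ g y
    block-mono-lo = proj₁ ∘ order

    block-mono-hi : ∀ {x y} → x at hi < y at hi → g x ≤ g y
    block-mono-hi {x} {y} lt with at-compare lo<k x y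
    ... | inj₁ lo-lt       = block-mono-lo lo-lt
    ... | inj₂ (inj₁ refl) = ℕP.≤-refl
    ... | inj₂ (inj₂ gt)   = ⊥-elim (ℕP.<-asym lt (same y x gt))

    -- two blocks apart means cut, so blocks of equal parity cannot be inverted
    block-mono-lo-hi : ∀ {x y} → parity (g x) ≡ parity (g y) → x at lo < y at hi → g x ≤ g y
    block-mono-lo-hi {x} {y} same-parity lt with at-compare lo<k x y
    ... | inj₁ lo-lt       = block-mono-lo lo-lt
    ... | inj₂ (inj₁ refl) = ℕP.≤-refl
    ... | inj₂ (inj₂ gt)   = parity-≤ same-parity
                               (ℕP.≮⇒≥ (λ far → ℕP.<-asym lt (proj₂ (proj₂ (order gt)) far)))

    block-cut : ∀ {x y} → x at hi < y at lo → g x < g y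
    block-cut {x} {y} cut with at-compare lo<k x y
    ... | inj₁ lo-lt       = proj₁ (proj₂ (order lo-lt)) cut
    ... | inj₂ (inj₁ refl) = ⊥-elim (ℕP.<-asym cut (occurrences-ordered lo<hi hi<k x))
    ... | inj₂ (inj₂ gt)   = ⊥-elim (ℕP.<-asym cut (ℕP.<-trans gt (occurrences-ordered lo<hi hi<k x)))

  OneOf : ℕ → ℕ → ℕ → Set
  OneOf lo hi c = c ≡ lo ⊎ c ≡ hi

  module Pair (X : Subset s) {lo hi} (lo<hi : lo < hi) (hi<k : hi < k)
              {q} {Q : Pred (Occ s) q} (Q? : Decidable Q)
              (selects : ∀ e → OneOf lo hi (proj₂ e) → Q e)
              (only : ∀ e → Q e → OneOf lo hi (proj₂ e)) where

    T : Seq s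
    T = map proj₁ (filter Q? (annot (restrict X S)))

    entries : List (Occ s)
    entries = filter Q? (filter (λ e → proj₁ e ∈? X) (annot S))

    annot-T : annot T ≡ map (renumber Q?) entries
    annot-T = trans (annot-filter Q? (restrict X S))
                    (cong (λ l → map (renumber Q?) (filter Q? l)) (annot-restrict X S))

    entry : ∀ {e} → e ∈ˡ entries → Q e × proj₁ e ∈ X
    entry e∈ with ∈P.∈-filter⁻ Q? {xs = filter _ (annot S)} e∈
    ... | e∈′ , Qe = Qe , proj₂ (∈P.∈-filter⁻ (λ e → proj₁ e ∈? X) {xs = annot S} e∈′)

    entries-sorted : AllPairs (λ e e′ → pos e < pos e′) entries
    entries-sorted = AllPairsP.filter⁺ Q? (AllPairsP.filter⁺ _ pos-increasing)

    -- in T, lo-th occurrences become first and hi-th occurrences second occurrences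
    newIndex : Fin s → ℕ → ℕ
    newIndex x c = proj₂ (renumber Q? (x , c))

    newIndex-lo : ∀ x → newIndex x lo ≡ 0
    newIndex-lo x = rank-none lo (λ n n<lo → dec-false (Q? (x , n)) (excluded n<lo ∘ only (x , n)))
      where
      excluded : ∀ {n} → n < lo → ¬ OneOf lo hi n
      excluded n<lo (inj₁ refl) = ℕP.<-irrefl refl n<lo
      excluded n<lo (inj₂ refl) = ℕP.<-asym n<lo lo<hi

    newIndex-hi : ∀ x → newIndex x hi ≡ 1
    newIndex-hi x = rank-single lo hi lo<hi (dec-true (Q? (x , lo)) (selects (x , lo) (inj₁ refl)))
                      (λ n n<hi n≢lo → dec-false (Q? (x , n)) (excluded n<hi n≢lo ∘ only (x , n)))
      where
      excluded : ∀ {n} → n < hi → ¬ n ≡ lo → ¬ OneOf lo hi n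
      excluded n<hi n≢lo (inj₁ n≡lo) = n≢lo n≡lo
      excluded n<hi n≢lo (inj₂ refl) = ℕP.<-irrefl refl n<hi

    newIndex<2 : ∀ x {c} → OneOf lo hi c → newIndex x c < 2
    newIndex<2 x (inj₁ refl) rewrite newIndex-lo x = s≤s z≤n
    newIndex<2 x (inj₂ refl) rewrite newIndex-hi x = s≤s (s≤s z≤n)

    KeysOrdered : (Fin s → ℕ) → Set
    KeysOrdered blk = ∀ {e e′} → e ∈ˡ entries → e′ ∈ˡ entries → pos e < pos e′ →
      blockKey blk (renumber Q? e) ≤ blockKey blk (renumber Q? e′)

    interleaving-from : (blk : Fin s → ℕ) → KeysOrdered blk → TwoRegInterleaving T
    interleaving-from blk keys-ordered = twoReg-from-sorted-keys T blk
      (subst (All _) (sym annot-T) (AllP.map⁺ (All.tabulate λ {e} e∈ → newIndex<2 _ (only e (proj₁ (entry e∈))))))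
      (subst (AllPairs _) (sym annot-T) (AllPairsP.map⁺ (AllPairs-weaken keys-ordered entries-sorted)))

    -- same direction: blocks are the greedy blocks, which on X all have one parity
    same-direction : SameDir lo hi → Monochromatic X (parity ∘ blockOf lo hi) → TwoRegInterleaving T
    same-direction same one-parity = interleaving-from g keys-ordered
      where
      open SameDirection lo<hi hi<k same
      g = blockOf lo hi
      keys : ∀ x c y d → OneOf lo hi c → OneOf lo hi d → parity (g x) ≡ parity (g y) →
        x at c < y at d → newIndex x c + g x * 2 ≤ newIndex y d + g y * 2
      keys x _ y _ (inj₁ refl) (inj₁ refl) _ lt rewrite newIndex-lo x | newIndex-lo y =
        ℕP.*-monoˡ-≤ 2 (block-mono-lo lt)
      keys x _ y _ (inj₂ refl) (inj₂ refl) _ lt rewrite newIndex-hi x | newIndex-hi y =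
        s≤s (ℕP.*-monoˡ-≤ 2 (block-mono-hi lt))
      keys x _ y _ (inj₁ refl) (inj₂ refl) p lt rewrite newIndex-lo x | newIndex-hi y =
        ℕP.m≤n⇒m≤1+n (ℕP.*-monoˡ-≤ 2 (block-mono-lo-hi p lt))
      keys x _ y _ (inj₂ refl) (inj₁ refl) _ lt rewrite newIndex-hi x | newIndex-lo y =
        ℕP.≤-trans (ℕP.n≤1+n _) (ℕP.*-monoˡ-≤ 2 (block-cut lt))
      keys-ordered : KeysOrdered g
      keys-ordered {x , c} {y , d} e∈ e′∈ with entry e∈ | entry e′∈
      ... | Qe , x∈ | Qe′ , y∈ = keys x c y d (only _ Qe) (only _ Qe′) (one-parity x∈ y∈)

    -- opposite direction: a single block suffices
    opposite-direction : OppDir lo hi → TwoRegInterleaving T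
    opposite-direction opp = interleaving-from (λ _ → 0) keys-ordered
      where
      keys : ∀ x c y d → OneOf lo hi c → OneOf lo hi d → x at c < y at d → newIndex x c + 0 ≤ newIndex y d + 0
      keys x _ y _ (inj₁ refl) _ lt rewrite newIndex-lo x = z≤n
      keys x _ y _ (inj₂ refl) (inj₂ refl) lt rewrite newIndex-hi x | newIndex-hi y = ℕP.≤-refl
      keys x _ y _ (inj₂ refl) (inj₁ refl) lt = ⊥-elim (opposite-separated lo<hi hi<k opp x y lt)
      keys-ordered : KeysOrdered (λ _ → 0)
      keys-ordered {x , c} {y , d} e∈ e′∈ = keys x c y d (only _ (proj₁ (entry e∈))) (only _ (proj₁ (entry e′∈)))

  pair-regular : PerReadMonotone k S → (X : Subset s) → All (Monochromatic X) colourings →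
    ∀ {lo hi} → lo < hi → hi < k → ∀ {q} {Q : Pred (Occ s) q} (Q? : Decidable Q) →
    (∀ e → OneOf lo hi (proj₂ e) → Q e) → (∀ e → Q e → OneOf lo hi (proj₂ e)) →
    TwoRegInterleaving (map proj₁ (filter Q? (annot (restrict X S))))
  pair-regular mono X monochrome {lo} {hi} lo<hi hi<k Q? selects only
    with directions (ℕP.<-trans lo<hi hi<k) hi<k (mono lo (ℕP.<-trans lo<hi hi<k)) (mono hi hi<k)
  ... | inj₁ same = Pair.same-direction X lo<hi hi<k Q? selects only same
                      (All.lookup monochrome (∈P.∈-map⁺ _ (∈-pairsBelow (ℕP.<-trans lo<hi hi<k) hi<k)))
  ... | inj₂ opp  = Pair.opposite-direction X lo<hi hi<k Q? selects only opp

  -- S^{(i,j)} selects the indices i and j, in either order.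
  k-regular : PerReadMonotone k S → (X : Subset s) → All (Monochromatic X) colourings →
    KRegInterleaving k (restrict X S)
  k-regular mono X monochrome i j i<k j<k i≢j with ℕP.<-cmp i j
  ... | tri< i<j _ _ = pair-regular mono X monochrome i<j j<k _ (λ _ → id) (λ _ → id)
  ... | tri≈ _ i≡j _ = ⊥-elim (i≢j i≡j)
  ... | tri> _ _ j<i = pair-regular mono X monochrome j<i i<k _ (λ _ → swap) (λ _ → swap)

corollary5p9 : ∀ (k s : ℕ) (S : Seq s) → ReadK k S → PerReadMonotone k S →
    ∃[ X′ ] (s ≤ 3 ^ (k * k) * ∣ X′ ∣
    × PerReadMonotone k (restrict X′ S)
    × KRegInterleaving k (restrict X′ S))
corollary5p9 k s S readK mono =
  X , size-bound , perReadMonotone-restrict X S mono , k-regular mono X monochrome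
  where
  open Main S readK
  open ℕP.≤-Reasoning
  X,large,monochrome = monochromatic-subset colourings ⊤
  X = proj₁ X,large,monochrome
  large = proj₁ (proj₂ (proj₂ X,large,monochrome))
  monochrome = proj₂ (proj₂ (proj₂ X,large,monochrome))
  size-bound : s ≤ 3 ^ (k * k) * ∣ X ∣
  size-bound = begin
    s                              ≡⟨ ∣⊤∣≡n s ⟨
    ∣ ⊤ {s} ∣                      ≤⟨ large ⟩
    2 ^ length colourings * ∣ X ∣  ≡⟨ cong (λ n → 2 ^ n * ∣ X ∣) length-colourings ⟩
    2 ^ (k * k) * ∣ X ∣            ≤⟨ ℕP.*-monoˡ-≤ ∣ X ∣ (ℕP.^-monoˡ-≤ (k * k) (s≤s (s≤s z≤n))) ⟩
    3 ^ (k * k) * ∣ X ∣            ∎
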